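{- Let $\mathcal M$ be (the set of covectors of) a sweep oriented matroid on the ground set $\binom{[n]}{2}$. Then \[\mathcal B(\mathcal M)=\{X^k : X\in\mathcal M,\ 1\le k\le 2l_X+1\}\subseteq\{+,-,0\}^{[n]\cup\binom{[n]}{2}}\] is the set of covectors of an oriented matroid on $[n]\cup\binom{[n]}{2}$.
   Context: Sign vectors: for $X\in\{+,-,0\}^E$, $-X$ switches $+$ and $-$; the composition is $(X\circ Y)_e=X_e$ if $X_e\neq0$ and $Y_e$ otherwise; the separation set is $S(X,Y)=\{e: \{X_e,Y_e\}=\{+,-\}\}$. An oriented matroid on $E$ is a set $\mathcal L\subseteq\{+,-,0\}^E$ (its covectors) with: (V0) $0\in\mathcal L$; (V1) $X\in\mathcal L\Rightarrow -X\in\mathcal L$; (V2) $X,Y\in\mathcal L\Rightarrow X\circ Y\in\mathcal L$; (V3) if $X,Y\in\mathcal L$ and $e\in S(X,Y)$ there is $Z\in\mathcal L$ with $Z_e=0$ and $Z_f=(X\circ Y)_f$ for all $f\notin S(X,Y)$. $\binom{[n]}{2}$ denotes the set of pairs $(i,j)$ with $1\le i<j\le n$. An ordered partition $I=(I_1,\dots,I_l)$ of $[n]$ (nonempty disjoint blocks with union $[n]$) corresponds to the surjection $p_I:[n]\to[l]$ with $p_I(i)=k$ iff $i\in I_k$; its sign vector $X^I\in\{+,-,0\}^{\binom{[n]}{2}}$ has $X^I_{(i,j)}=+,-,0$ according as $p_I(i)<p_I(j)$, $p_I(i)>p_I(j)$, $p_I(i)=p_I(j)$. The braid oriented matroid $\mathcal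 A_n$ is the oriented matroid on $\binom{[n]}{2}$ whose covectors are exactly the $X^I$ for all ordered partitions $I$ of $[n]$ (the oriented matroid of the vectors $e_j-e_i$). A sweep oriented matroid is an oriented matroid on $\binom{[n]}{2}$ every covector of which is a covector of $\mathcal A_n$. For a covector $X$ of a sweep oriented matroid, $I_X$ is the ordered partition with $X=X^{I_X}$, $l_X$ its number of blocks and $p_X=p_{I_X}$. For $1\le k\le 2l_X+1$, $X^k\in\{+,-,0\}^{[n]\cup\binom{[n]}{2}}$ is defined by $X^k_{(i,j)}=X_{(i,j)}$ and, for $i\in[n]$: $X^k_i=-$ if $p_X(i)\le\lfloor\frac{k-1}{2}\rfloor$; $X^k_i=+$ if $p_X(i)>\lfloor\frac k2\rfloor$; $X^k_i=0$ if $k$ is even and $p_X(i)=\frac k2$. -}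

module Defs where

open import Data.Nat using (ℕ; zero; suc; _≤_; _<_; _∸_; _≤ᵇ_; _<ᵇ_; ⌊_/2⌋)
open import Data.Fin using (Fin; toℕ)
import Data.Fin as F
open import Data.Bool using (Bool; true; false; if_then_else_)
open import Data.Sum using (_⊎_; inj₁; inj₂)
open import Data.Product using (Σ; ∃; _×_; _,_)
open import Relation.Binary.PropositionalEquality using (_≡_)
open import Relation.Nullary using (¬_)

data Sign : Set where
  plus minus zer : Sign

SignVec : Set → Set
SignVec E = E → Sign

negS : Sign → Sign
negS plus  = minus
negS minus = plus
negS zer   = zer

neg : {E : Set} → SignVec E → SignVec E
neg X e = negS (X e)

_⊙_ : {E : Set} → SignVec E → SignVec E → SignVec E
(X ⊙ Y) e with X e
... | zer = Y e
... | s   = s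

zeroVec : {E : Set} → SignVec E
zeroVec _ = zer

Opposite : Sign → Sign → Set
Opposite s t = (s ≡ plus × t ≡ minus) ⊎ (s ≡ minus × t ≡ plus)

Sep : {E : Set} → SignVec E → SignVec E → E → Set
Sep X Y e = Opposite (X e) (Y e)

record IsOM (E : Set) (L : SignVec E → Set) : Set where
  field
    V0 : L zeroVec
    V1 : ∀ X → L X → L (neg X)
    V2 : ∀ X Y → L X → L Y → L (X ⊙ Y)
    V3 : ∀ X Y → L X → L Y → ∀ e → Sep X Y e →
           Σ (SignVec E) λ Z → L Z × Z e ≡ zer ×
             (∀ f → ¬ Sep X Y f → Z f ≡ (X ⊙ Y) f)

record Pair (n : ℕ) : Set where
  constructor pair
  field
    fst : Fin n
    snd : Fin n
    lt  : fst F.< snd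

Ext : ℕ → Set
Ext n = Fin n ⊎ Pair n

-- Ordered partitions as surjections p : [n] → [l]  (blocks 0-indexed here)

Surj : {n l : ℕ} → (Fin n → Fin l) → Set
Surj {n} {l} p = ∀ (b : Fin l) → Σ (Fin n) λ a → p a ≡ b

cmpSign : ℕ → ℕ → Sign
cmpSign a b = if a <ᵇ b then plus else (if b <ᵇ a then minus else zer)

XI : {n l : ℕ} → (Fin n → Fin l) → SignVec (Pair n)
XI p (pair i j _) = cmpSign (toℕ (p i)) (toℕ (p j))

_≗S_ : {E : Set} → SignVec E → SignVec E → Set
X ≗S Y = ∀ e → X e ≡ Y e

BraidCov : (n : ℕ) → SignVec (Pair n) → Set
BraidCov n X = Σ ℕ λ l → Σ (Fin n → Fin l) λ p → Surj p × X ≗S XI p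

record IsSweepOM (n : ℕ) (M : SignVec (Pair n) → Set) : Set where
  field
    isOM  : IsOM (Pair n) M
    sweep : ∀ X → M X → BraidCov n X

-- X^k.  With 1-indexed block number q = toℕ (p i) + 1:
--   X^k_i = -  if q ≤ ⌊(k-1)/2⌋ ;  +  if q > ⌊k/2⌋ ;  0 otherwise
-- (the last case is exactly: k even and q = k/2).

liftSign : {n l : ℕ} → (Fin n → Fin l) → ℕ → Fin n → Sign
liftSign p k i =
  if suc (toℕ (p i)) ≤ᵇ ⌊ k ∸ 1 /2⌋ then minus
  else (if ⌊ k /2⌋ <ᵇ suc (toℕ (p i)) then plus else zer)

Xk : {n l : ℕ} → (Fin n → Fin l) → SignVec (Pair n) → ℕ → SignVec (Ext n)
Xk p X k (inj₁ i) = liftSign p k i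
Xk p X k (inj₂ e) = X e

-- B(M) = { X^k : X ∈ M, 1 ≤ k ≤ 2 l_X + 1 }, where (l_X, p_X) is the
-- (unique) ordered partition with X = X^{I_X}.
B : (n : ℕ) → (SignVec (Pair n) → Set) → SignVec (Ext n) → Set
B n M Y =
  Σ (SignVec (Pair n)) λ X → M X ×
  Σ ℕ λ l → Σ (Fin n → Fin l) λ p → Surj p × X ≗S XI p ×
  Σ ℕ λ k → 1 ≤ k × k ≤ suc (2 Data.Nat.* l) × Y ≗S Xk p X k

-- Read X^k as the braid covector of I_X with one more point inserted at position k/2
-- (inside a block for k even, between two blocks for k odd). Then Y lies in B(M) exactly
-- when its restriction X to the pairs lies in M and, for all i < j, the signs Y_i, Y_j,
-- X_ij are realisable by three points of a line; conversely every partial sign assignment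
-- on [n] that is realisable in this sense together with some X ∈ M extends to an element
-- of B(M) over X (put the new point as far right as allowed). Since realisability of such
-- triples survives negation, composition and elimination, V0-V2 and elimination at a pair
-- are inherited from M, composing the signs on [n] coordinatewise. Elimination between Y
-- and Y′ at an element a goes by induction on the pairs separating them: if there are
-- none, X ∘ X′ with a zero put at a works; otherwise eliminating at a separating pair gives
-- W, and either W_a = 0, or replacing Y′ by W ∘ Y (or Y by W ∘ Y′) keeps a separated,
-- removes that pair from the separation set and does not change Y ∘ Y′ off it.

module Submission where

open import Defs
open import Data.Nat using (ℕ; zero; suc; _≤_; _<_; _∸_; _≤ᵇ_; _<ᵇ_; ⌊_/2⌋; z≤n; s≤s; _*_)
open import Data.Nat.Properties
  using (<-cmp; ≤-refl; ≤-antisym; <⇒≤; m≤n⇒m≤1+n; *-suc; *-monoʳ-≤; *-monoʳ-<)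
open import Data.Fin using (Fin; toℕ)
import Data.Fin as F
import Data.Fin.Properties as FP
open import Data.Bool using (Bool; true; false; T; _∧_; not; if_then_else_)
open import Data.Bool.Properties using (T?)
open import Data.Unit using (⊤; tt)
open import Data.Empty using (⊥-elim)
open import Data.Product using (Σ; Σ-syntax; _×_; _,_; proj₁)
open import Data.Sum using (_⊎_; inj₁; inj₂; [_,_])
open import Data.List using (List; []; _∷_; tabulate; allFin; cartesianProduct)
import Data.List.Relation.Unary.All.Properties as All
import Data.List.Relation.Unary.Any.Properties as Any
open import Data.List.Relation.Unary.Any using (here; there)
open import Data.List.Membership.Propositional using (_∈_)
open import Data.List.Membership.Propositional.Properties using (∈-allFin; ∈-cartesianProduct⁺)
open import Data.List.Extrema.Nat using (min; min≤⊤; min≤v⁺; v≤min⁺)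
open import Data.Vec.Functional using (updateAt)
open import Data.Vec.Functional.Properties using (updateAt-updates; updateAt-minimal)
open import Function using (_∘_; case_of_)
open import Relation.Binary using (tri<; tri≈; tri>)
open import Relation.Binary.Definitions using (DecidableEquality)
open import Relation.Binary.PropositionalEquality hiding ([_])
open import Relation.Nullary using (¬_; Dec; yes; no)
open import Relation.Nullary.Decidable using (map′; toWitness; _×-dec_; _⊎-dec_; _→-dec_; ¬?)

infixr 5 _⊙ˢ_
infix 4 _≟ˢ_

_⊙ˢ_ : Sign → Sign → Sign
plus  ⊙ˢ _ = plus
minus ⊙ˢ _ = minus
zer   ⊙ˢ t = t

⊙-pointwise : ∀ {E : Set} (X Y : SignVec E) e → (X ⊙ Y) e ≡ X e ⊙ˢ Y e
⊙-pointwise X Y e with X e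
... | plus  = refl
... | minus = refl
... | zer   = refl

⊙ˢ-identityʳ : ∀ s → s ⊙ˢ zer ≡ s
⊙ˢ-identityʳ plus  = refl
⊙ˢ-identityʳ minus = refl
⊙ˢ-identityʳ zer   = refl

⊙ˢ-idem : ∀ s → s ⊙ˢ s ≡ s
⊙ˢ-idem plus  = refl
⊙ˢ-idem minus = refl
⊙ˢ-idem zer   = refl

⊙ˢ-absorbˡ : ∀ s t → s ⊙ˢ ((s ⊙ˢ t) ⊙ˢ s) ≡ s ⊙ˢ t
⊙ˢ-absorbˡ plus  t = refl
⊙ˢ-absorbˡ minus t = refl
⊙ˢ-absorbˡ zer   t = ⊙ˢ-identityʳ t

⊙ˢ-absorbʳ : ∀ s t → (s ⊙ˢ t) ⊙ˢ t ≡ s ⊙ˢ t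
⊙ˢ-absorbʳ plus  t = refl
⊙ˢ-absorbʳ minus t = refl
⊙ˢ-absorbʳ zer   t = ⊙ˢ-idem t

_≟ˢ_ : DecidableEquality Sign
plus  ≟ˢ plus  = yes refl
minus ≟ˢ minus = yes refl
zer   ≟ˢ zer   = yes refl
plus  ≟ˢ minus = no λ ()
plus  ≟ˢ zer   = no λ ()
minus ≟ˢ plus  = no λ ()
minus ≟ˢ zer   = no λ ()
zer   ≟ˢ plus  = no λ ()
zer   ≟ˢ minus = no λ ()

opposite? : ∀ s t → Dec (Opposite s t)
opposite? s t = (s ≟ˢ plus ×-dec t ≟ˢ minus) ⊎-dec (s ≟ˢ minus ×-dec t ≟ˢ plus)

opposite-irrefl : ∀ {s} → ¬ Opposite s s
opposite-irrefl (inj₁ (refl , ()))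
opposite-irrefl (inj₂ (refl , ()))

opposite-⊙ˢˡ : ∀ {w s} t → Opposite w s → Opposite (w ⊙ˢ t) s
opposite-⊙ˢˡ t (inj₁ (refl , refl)) = inj₁ (refl , refl)
opposite-⊙ˢˡ t (inj₂ (refl , refl)) = inj₂ (refl , refl)

opposite-⊙ˢʳ : ∀ {s w} t → Opposite s w → Opposite s (w ⊙ˢ t)
opposite-⊙ˢʳ t (inj₁ (refl , refl)) = inj₁ (refl , refl)
opposite-⊙ˢʳ t (inj₂ (refl , refl)) = inj₂ (refl , refl)

¬opposite-absorbˡ : ∀ s t u → ¬ Opposite s ((s ⊙ˢ t) ⊙ˢ u)
¬opposite-absorbˡ plus  t u = opposite-irrefl
¬opposite-absorbˡ minus t u = opposite-irrefl
¬opposite-absorbˡ zer   t u (inj₁ (() , _))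
¬opposite-absorbˡ zer   t u (inj₂ (() , _))

¬opposite-absorbʳ : ∀ s t → ¬ Opposite s t → ¬ Opposite ((s ⊙ˢ t) ⊙ˢ t) t
¬opposite-absorbʳ s t ¬o rewrite ⊙ˢ-absorbʳ s t with s
... | plus  = ¬o
... | minus = ¬o
... | zer   = opposite-irrefl

opposite-trichotomy : ∀ {s s′} → Opposite s s′ → ∀ w → w ≡ zer ⊎ Opposite s w ⊎ Opposite w s′
opposite-trichotomy o zer = inj₁ refl
opposite-trichotomy (inj₁ (refl , refl)) plus  = inj₂ (inj₂ (inj₁ (refl , refl)))
opposite-trichotomy (inj₁ (refl , refl)) minus = inj₂ (inj₁ (inj₁ (refl , refl)))
opposite-trichotomy (inj₂ (refl , refl)) plus  = inj₂ (inj₁ (inj₂ (refl , refl)))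
opposite-trichotomy (inj₂ (refl , refl)) minus = inj₂ (inj₂ (inj₂ (refl , refl)))

isZer : Sign → Bool
isZer zer = true
isZer _   = false

_≤ᵇˢ_ : Sign → Sign → Bool
minus ≤ᵇˢ _     = true
zer   ≤ᵇˢ minus = false
zer   ≤ᵇˢ _     = true
plus  ≤ᵇˢ plus  = true
plus  ≤ᵇˢ _     = false

-- Consistent s t r says that s, t, r can be the signs cmpSign x₀ x, cmpSign x₀ y
-- and cmpSign x y of three points x₀, x, y of a line.
consistentᵇ : Sign → Sign → Sign → Bool
consistentᵇ s t plus  = s ≤ᵇˢ t ∧ not (isZer s ∧ isZer t)
consistentᵇ s t minus = t ≤ᵇˢ s ∧ not (isZer s ∧ isZer t)
consistentᵇ s t zer   = s ≤ᵇˢ t ∧ t ≤ᵇˢ s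

record Consistent (s t r : Sign) : Set where
  field holds : T (consistentᵇ s t r)

consistent? : ∀ s t r → Dec (Consistent s t r)
consistent? s t r = map′ (λ h → record { holds = h }) Consistent.holds (T? (consistentᵇ s t r))

consistent-refl : ∀ s → Consistent s s zer
consistent-refl plus  = _
consistent-refl minus = _
consistent-refl zer   = _

consistent-plus-plus : ∀ r → Consistent plus plus r
consistent-plus-plus plus  = _
consistent-plus-plus minus = _
consistent-plus-plus zer   = _

consistent-minus-plus : ∀ t → Consistent minus t plus
consistent-minus-plus plus  = _
consistent-minus-plus minus = _
consistent-minus-plus zer   = _

consistent-minus-minus : ∀ s → Consistent s minus minus
consistent-minus-minus plus  = _
consistent-minus-minus minus = _
consistent-minus-minus zer   = _

∀ˢ? : {P : Sign → Set} → (∀ s → Dec (P s)) → Dec (∀ s → P s)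
∀ˢ? P? = map′ (λ { (p , m , z) plus → p ; (p , m , z) minus → m ; (p , m , z) zer → z })
              (λ h → h plus , h minus , h zer)
              (P? plus ×-dec P? minus ×-dec P? zer)

consistent-swap : ∀ s t r → Consistent s t r → Consistent t s (negS r)
consistent-swap = toWitness {a? =
  ∀ˢ? λ s → ∀ˢ? λ t → ∀ˢ? λ r → consistent? s t r →-dec consistent? t s (negS r)} _

consistent-neg : ∀ s t r → Consistent s t r → Consistent (negS s) (negS t) (negS r)
consistent-neg = toWitness {a? =
  ∀ˢ? λ s → ∀ˢ? λ t → ∀ˢ? λ r → consistent? s t r →-dec consistent? (negS s) (negS t) (negS r)} _

consistent-⊙ : ∀ s t r s′ t′ r′ → Consistent s t r → Consistent s′ t′ r′ →
  Consistent (s ⊙ˢ s′) (t ⊙ˢ t′) (r ⊙ˢ r′)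
consistent-⊙ = toWitness {a? =
  ∀ˢ? λ s → ∀ˢ? λ t → ∀ˢ? λ r → ∀ˢ? λ s′ → ∀ˢ? λ t′ → ∀ˢ? λ r′ →
  consistent? s t r →-dec consistent? s′ t′ r′ →-dec consistent? (s ⊙ˢ s′) (t ⊙ˢ t′) (r ⊙ˢ r′)} _

consistent-elim : ∀ s t r s′ t′ r′ r″ → Consistent s t r → Consistent s′ t′ r′ →
  ¬ Opposite s s′ → ¬ Opposite t t′ → r″ ≡ r ⊙ˢ r′ ⊎ Opposite r r′ →
  Consistent (s ⊙ˢ s′) (t ⊙ˢ t′) r″
consistent-elim = toWitness {a? =
  ∀ˢ? λ s → ∀ˢ? λ t → ∀ˢ? λ r → ∀ˢ? λ s′ → ∀ˢ? λ t′ → ∀ˢ? λ r′ → ∀ˢ? λ r″ →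
  consistent? s t r →-dec consistent? s′ t′ r′ →-dec ¬? (opposite? s s′) →-dec ¬? (opposite? t t′) →-dec
  (r″ ≟ˢ r ⊙ˢ r′ ⊎-dec opposite? r r′) →-dec consistent? (s ⊙ˢ s′) (t ⊙ˢ t′) r″} _

consistent-zeroˡ : ∀ s t r s′ t′ r′ → Opposite s s′ → Consistent s t r → Consistent s′ t′ r′ →
  ¬ Opposite t t′ → ¬ Opposite r r′ → Consistent zer (t ⊙ˢ t′) (r ⊙ˢ r′)
consistent-zeroˡ = toWitness {a? =
  ∀ˢ? λ s → ∀ˢ? λ t → ∀ˢ? λ r → ∀ˢ? λ s′ → ∀ˢ? λ t′ → ∀ˢ? λ r′ →
  opposite? s s′ →-dec consistent? s t r →-dec consistent? s′ t′ r′ →-dec ¬? (opposite? t t′) →-dec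
  ¬? (opposite? r r′) →-dec consistent? zer (t ⊙ˢ t′) (r ⊙ˢ r′)} _

consistent-zeroʳ : ∀ s t r s′ t′ r′ → Opposite t t′ → Consistent s t r → Consistent s′ t′ r′ →
  ¬ Opposite s s′ → ¬ Opposite r r′ → Consistent (s ⊙ˢ s′) zer (r ⊙ˢ r′)
consistent-zeroʳ = toWitness {a? =
  ∀ˢ? λ s → ∀ˢ? λ t → ∀ˢ? λ r → ∀ˢ? λ s′ → ∀ˢ? λ t′ → ∀ˢ? λ r′ →
  opposite? t t′ →-dec consistent? s t r →-dec consistent? s′ t′ r′ →-dec ¬? (opposite? s s′) →-dec
  ¬? (opposite? r r′) →-dec consistent? (s ⊙ˢ s′) zer (r ⊙ˢ r′)} _

cmpSign-refl : ∀ a → cmpSign a a ≡ zer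
cmpSign-refl zero    = refl
cmpSign-refl (suc a) = cmpSign-refl a

cmpSign-< : ∀ {a b} → a < b → cmpSign a b ≡ plus
cmpSign-< {zero}  {suc b} _         = refl
cmpSign-< {suc a} {suc b} (s≤s a<b) = cmpSign-< a<b

cmpSign-> : ∀ {a b} → b < a → cmpSign a b ≡ minus
cmpSign-> {suc a} {zero}  _         = refl
cmpSign-> {suc a} {suc b} (s≤s b<a) = cmpSign-> b<a

cmpSign-swap : ∀ a b → negS (cmpSign a b) ≡ cmpSign b a
cmpSign-swap zero    zero    = refl
cmpSign-swap zero    (suc b) = refl
cmpSign-swap (suc a) zero    = refl
cmpSign-swap (suc a) (suc b) = cmpSign-swap a b

cmpSign-mono : (g : ℕ → ℕ) → (∀ {a b} → a < b → g a < g b) →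
  ∀ a b → cmpSign (g a) (g b) ≡ cmpSign a b
cmpSign-mono g g-mono a b with <-cmp a b
... | tri< a<b _ _    = trans (cmpSign-< (g-mono a<b)) (sym (cmpSign-< a<b))
... | tri≈ _ refl _   = trans (cmpSign-refl (g a)) (sym (cmpSign-refl a))
... | tri> _ _ b<a    = trans (cmpSign-> (g-mono b<a)) (sym (cmpSign-> b<a))

cmpSign-consistent : ∀ x y z → Consistent (cmpSign x y) (cmpSign x z) (cmpSign y z)
cmpSign-consistent zero    zero    zero    = _
cmpSign-consistent zero    zero    (suc z) = _
cmpSign-consistent zero    (suc y) zero    = _
cmpSign-consistent zero    (suc y) (suc z) = consistent-plus-plus (cmpSign y z)
cmpSign-consistent (suc x) zero    zero    = _
cmpSign-consistent (suc x) zero    (suc z) = consistent-minus-plus (cmpSign x z)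
cmpSign-consistent (suc x) (suc y) zero    = consistent-minus-minus (cmpSign x y)
cmpSign-consistent (suc x) (suc y) (suc z) = cmpSign-consistent x y z

-- Measured in half-blocks, X^k puts a new point at position k, while block q
-- (counted from 0) sits at position 2(q + 1).
blockSign : ℕ → ℕ → Sign
blockSign k q = if suc q ≤ᵇ ⌊ k ∸ 1 /2⌋ then minus else (if ⌊ k /2⌋ <ᵇ suc q then plus else zer)

blockSign≡cmpSign : ∀ k q → blockSign k q ≡ cmpSign k (suc (suc (2 * q)))
blockSign≡cmpSign zero                q       = refl
blockSign≡cmpSign (suc zero)          zero    = refl
blockSign≡cmpSign (suc zero)          (suc q) = refl
blockSign≡cmpSign (suc (suc zero))    zero    = refl
blockSign≡cmpSign (suc (suc zero))    (suc q) = refl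
blockSign≡cmpSign (suc (suc (suc k))) zero    = refl
blockSign≡cmpSign (suc (suc (suc k))) (suc q) =
  trans (blockSign≡cmpSign (suc k) q) (cong (cmpSign (suc k)) (sym (*-suc 2 q)))

position : ℕ → ℕ
position q = suc (suc (2 * q))

position-< : ∀ {a b} → a < b → position a < position b
position-< a<b = s≤s (s≤s (*-monoʳ-< 2 a<b))

liftSign≡cmpSign : ∀ {n l} (p : Fin n → Fin l) k i → liftSign p k i ≡ cmpSign k (position (toℕ (p i)))
liftSign≡cmpSign p k i = blockSign≡cmpSign k (toℕ (p i))

liftSign-consistent : ∀ {n l} (p : Fin n → Fin l) k i j →
  Consistent (liftSign p k i) (liftSign p k j) (cmpSign (toℕ (p i)) (toℕ (p j)))
liftSign-consistent p k i j
  rewrite liftSign≡cmpSign p k i | liftSign≡cmpSign p k j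
        | sym (cmpSign-mono position position-< (toℕ (p i)) (toℕ (p j)))
  = cmpSign-consistent k (position (toℕ (p i))) (position (toℕ (p j)))

position-≤ : ∀ {a b} → a < b → position a ≤ 2 * b
position-≤ {a} {b} a<b = subst (_≤ 2 * b) (*-suc 2 a) (*-monoʳ-≤ 2 a<b)

-- The sign s of block a confines the position k of the new point to
-- signFloor s a ≤ k ≤ signBound l s a.
signFloor : Sign → ℕ → ℕ
signFloor minus a = suc (position a)
signFloor zer   a = position a
signFloor plus  a = 0

signBound : ℕ → Sign → ℕ → ℕ
signBound l minus a = suc (2 * l)
signBound l zer   a = position a
signBound l plus  a = suc (2 * a)

cmpSign-within : ∀ {l k a} s → signFloor s a ≤ k → k ≤ signBound l s a → cmpSign k (position a) ≡ s
cmpSign-within minus pos<k _ = cmpSign-> pos<k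
cmpSign-within {a = a} zer pos≤k k≤pos rewrite ≤-antisym k≤pos pos≤k = cmpSign-refl (position a)
cmpSign-within plus _ k≤2a = cmpSign-< (s≤s k≤2a)

signFloor≤top : ∀ {l a} s → a < l → signFloor s a ≤ suc (2 * l)
signFloor≤top minus a<l = s≤s (position-≤ a<l)
signFloor≤top zer   a<l = m≤n⇒m≤1+n (position-≤ a<l)
signFloor≤top plus  _   = z≤n

signBound-positive : ∀ {l} t b → 1 ≤ signBound l t b
signBound-positive minus _ = s≤s z≤n
signBound-positive zer   _ = s≤s z≤n
signBound-positive plus  _ = s≤s z≤n

signFloor≤signBound : ∀ {l a b} s t → a < l → Consistent s t (cmpSign a b) → signFloor s a ≤ signBound l t b
signFloor≤signBound plus _ _ _ = z≤n
signFloor≤signBound s minus a<l _ = signFloor≤top s a<l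
signFloor≤signBound {a = a} {b} minus zer _ c with <-cmp a b
... | tri< a<b _ _  = position-< a<b
... | tri≈ _ refl _ = ⊥-elim (Consistent.holds (subst (Consistent minus zer) (cmpSign-refl a) c))
... | tri> _ _ b<a  = ⊥-elim (Consistent.holds (subst (Consistent minus zer) (cmpSign-> b<a) c))
signFloor≤signBound {a = a} {b} minus plus _ c with <-cmp a b
... | tri< a<b _ _  = s≤s (position-≤ a<b)
... | tri≈ _ refl _ = ⊥-elim (Consistent.holds (subst (Consistent minus plus) (cmpSign-refl a) c))
... | tri> _ _ b<a  = ⊥-elim (Consistent.holds (subst (Consistent minus plus) (cmpSign-> b<a) c))
signFloor≤signBound {a = a} {b} zer zer _ c with <-cmp a b
... | tri< a<b _ _  = <⇒≤ (position-< a<b)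
... | tri≈ _ refl _ = ≤-refl
... | tri> _ _ b<a  = ⊥-elim (Consistent.holds (subst (Consistent zer zer) (cmpSign-> b<a) c))
signFloor≤signBound {a = a} {b} zer plus _ c with <-cmp a b
... | tri< a<b _ _  = m≤n⇒m≤1+n (position-≤ a<b)
... | tri≈ _ refl _ = ⊥-elim (Consistent.holds (subst (Consistent zer plus) (cmpSign-refl a) c))
... | tri> _ _ b<a  = ⊥-elim (Consistent.holds (subst (Consistent zer plus) (cmpSign-> b<a) c))

module _ {n l : ℕ} (p : Fin n → Fin l) {D : Fin n → Set} (D? : ∀ i → Dec (D i)) (f : Fin n → Sign)
         (f-consistent : ∀ {i j} → D i → D j → Consistent (f i) (f j) (cmpSign (toℕ (p i)) (toℕ (p j))))
         where

  private
    bound : Fin n → ℕ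
    bound j with D? j
    ... | yes _ = signBound l (f j) (toℕ (p j))
    ... | no _  = suc (2 * l)

    -- the new point is placed as far right as the prescribed signs allow
    k : ℕ
    k = min (suc (2 * l)) (tabulate bound)

    1≤bound : ∀ j → 1 ≤ bound j
    1≤bound j with D? j
    ... | yes _ = signBound-positive (f j) _
    ... | no _  = s≤s z≤n

    k≤bound : ∀ {i} → D i → k ≤ signBound l (f i) (toℕ (p i))
    k≤bound {i} di with D? i
                      | min≤v⁺ {v = bound i} (suc (2 * l)) (tabulate bound) (inj₂ (Any.tabulate⁺ i ≤-refl))
    ... | yes _  | k≤ = k≤
    ... | no ¬di | _  = ⊥-elim (¬di di)

    floor≤bound : ∀ {i} → D i → ∀ j → signFloor (f i) (toℕ (p i)) ≤ bound j
    floor≤bound {i} di j with D? j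
    ... | yes dj = signFloor≤signBound (f i) (f j) (FP.toℕ<n (p i)) (f-consistent di dj)
    ... | no _   = signFloor≤top (f i) (FP.toℕ<n (p i))

    floor≤k : ∀ {i} → D i → signFloor (f i) (toℕ (p i)) ≤ k
    floor≤k {i} di = v≤min⁺ (signFloor≤top (f i) (FP.toℕ<n (p i))) (All.tabulate⁺ (floor≤bound di))

  liftSign-extends : Σ[ k ∈ ℕ ] 1 ≤ k × k ≤ suc (2 * l) × (∀ i → D i → liftSign p k i ≡ f i)
  liftSign-extends =
    k , v≤min⁺ (s≤s z≤n) (All.tabulate⁺ 1≤bound) , min≤⊤ (suc (2 * l)) (tabulate bound) ,
    λ i di → trans (liftSign≡cmpSign p k i) (cmpSign-within (f i) (floor≤k di) (k≤bound di))

AgreesOffSep : ∀ {E} → SignVec E → SignVec E → SignVec E → Set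
AgreesOffSep Z X Y = ∀ f → ¬ Sep X Y f → Z f ≡ (X ⊙ Y) f

Elimination : {E : Set} → (SignVec E → Set) → SignVec E → SignVec E → E → Set
Elimination {E} L X Y e = Σ (SignVec E) λ Z → L Z × Z e ≡ zer × AgreesOffSep Z X Y

elimination-transfer : ∀ {E L} {Y Y′ V V′ : SignVec E} {e} →
  (∀ f → Sep V V′ f → Sep Y Y′ f) → AgreesOffSep (V ⊙ V′) Y Y′ →
  Elimination L V V′ e → Elimination L Y Y′ e
elimination-transfer sep⊆ agree (Z , Z∈L , Z-e , Z-agrees) =
  Z , Z∈L , Z-e , λ f ¬sep → trans (Z-agrees f (¬sep ∘ sep⊆ f)) (agree f ¬sep)

agrees-or-separated : ∀ {E} {X X′ U : SignVec E} → AgreesOffSep U X X′ →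
  ∀ f → U f ≡ X f ⊙ˢ X′ f ⊎ Opposite (X f) (X′ f)
agrees-or-separated {X = X} {X′} U-agrees f with opposite? (X f) (X′ f)
... | yes o  = inj₂ o
... | no ¬o = inj₁ (trans (U-agrees f ¬o) (⊙-pointwise X X′ f))

module _ {E : Set} {Y Y′ W : SignVec E} (W-agrees : AgreesOffSep W Y Y′) where

  private
    W-composed : ∀ {f} → ¬ Opposite (Y f) (Y′ f) → W f ≡ Y f ⊙ˢ Y′ f
    W-composed {f} ¬o = trans (W-agrees f ¬o) (⊙-pointwise Y Y′ f)

  sep-⊙ˡ : ∀ f → Sep Y (W ⊙ Y) f → Sep Y Y′ f
  sep-⊙ˡ f sep with opposite? (Y f) (Y′ f)
  ... | yes o  = o
  ... | no ¬o = ⊥-elim (¬opposite-absorbˡ (Y f) (Y′ f) (Y f)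
                   (subst (Opposite (Y f)) (trans (⊙-pointwise W Y f) (cong (_⊙ˢ Y f) (W-composed ¬o))) sep))

  sep-⊙ʳ : ∀ f → Sep (W ⊙ Y′) Y′ f → Sep Y Y′ f
  sep-⊙ʳ f sep with opposite? (Y f) (Y′ f)
  ... | yes o  = o
  ... | no ¬o = ⊥-elim (¬opposite-absorbʳ (Y f) (Y′ f) ¬o
                   (subst (λ s → Opposite s (Y′ f))
                     (trans (⊙-pointwise W Y′ f) (cong (_⊙ˢ Y′ f) (W-composed ¬o))) sep))

  agrees-⊙ˡ : ∀ f → ¬ Sep Y Y′ f → (Y ⊙ (W ⊙ Y)) f ≡ (Y ⊙ Y′) f
  agrees-⊙ˡ f ¬sep = begin
    (Y ⊙ (W ⊙ Y)) f                ≡⟨ ⊙-pointwise Y (W ⊙ Y) f ⟩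
    Y f ⊙ˢ (W ⊙ Y) f               ≡⟨ cong (Y f ⊙ˢ_) (⊙-pointwise W Y f) ⟩
    Y f ⊙ˢ W f ⊙ˢ Y f              ≡⟨ cong (λ w → Y f ⊙ˢ w ⊙ˢ Y f) (W-composed ¬sep) ⟩
    Y f ⊙ˢ (Y f ⊙ˢ Y′ f) ⊙ˢ Y f    ≡⟨ ⊙ˢ-absorbˡ (Y f) (Y′ f) ⟩
    Y f ⊙ˢ Y′ f                    ≡⟨ ⊙-pointwise Y Y′ f ⟨
    (Y ⊙ Y′) f                     ∎
    where open ≡-Reasoning

  agrees-⊙ʳ : ∀ f → ¬ Sep Y Y′ f → ((W ⊙ Y′) ⊙ Y′) f ≡ (Y ⊙ Y′) f
  agrees-⊙ʳ f ¬sep = begin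
    ((W ⊙ Y′) ⊙ Y′) f              ≡⟨ ⊙-pointwise (W ⊙ Y′) Y′ f ⟩
    (W ⊙ Y′) f ⊙ˢ Y′ f             ≡⟨ cong (_⊙ˢ Y′ f) (⊙-pointwise W Y′ f) ⟩
    (W f ⊙ˢ Y′ f) ⊙ˢ Y′ f          ≡⟨ ⊙ˢ-absorbʳ (W f) (Y′ f) ⟩
    W f ⊙ˢ Y′ f                    ≡⟨ cong (_⊙ˢ Y′ f) (W-composed ¬sep) ⟩
    (Y f ⊙ˢ Y′ f) ⊙ˢ Y′ f          ≡⟨ ⊙ˢ-absorbʳ (Y f) (Y′ f) ⟩
    Y f ⊙ˢ Y′ f                    ≡⟨ ⊙-pointwise Y Y′ f ⟨
    (Y ⊙ Y′) f                     ∎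
    where open ≡-Reasoning

separates-⊙ˡ : ∀ {E} (Y W : SignVec E) {f} → Opposite (Y f) (W f) → Sep Y (W ⊙ Y) f
separates-⊙ˡ Y W {f} o = subst (Opposite (Y f)) (sym (⊙-pointwise W Y f)) (opposite-⊙ˢʳ (Y f) o)

separates-⊙ʳ : ∀ {E} (W Y′ : SignVec E) {f} → Opposite (W f) (Y′ f) → Sep (W ⊙ Y′) Y′ f
separates-⊙ʳ W Y′ {f} o =
  subst (λ s → Opposite s (Y′ f)) (sym (⊙-pointwise W Y′ f)) (opposite-⊙ˢˡ (Y′ f) o)

zero-⊙ˡ : ∀ {E} (Y W : SignVec E) {f} → W f ≡ zer → ¬ Sep Y (W ⊙ Y) f
zero-⊙ˡ Y W {f} W-f sep =
  opposite-irrefl (subst (Opposite (Y f)) (trans (⊙-pointwise W Y f) (cong (_⊙ˢ Y f) W-f)) sep)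

zero-⊙ʳ : ∀ {E} (W Y′ : SignVec E) {f} → W f ≡ zer → ¬ Sep (W ⊙ Y′) Y′ f
zero-⊙ʳ W Y′ {f} W-f sep =
  opposite-irrefl (subst (λ s → Opposite s (Y′ f)) (trans (⊙-pointwise W Y′ f) (cong (_⊙ˢ Y′ f) W-f)) sep)

coords : ∀ {n} → Pair n → Fin n × Fin n
coords (pair i j _) = i , j

coords-injective : ∀ {n} {g h : Pair n} → coords g ≡ coords h → g ≡ h
coords-injective {g = pair i j i<j} {pair .i .j i<j′} refl = cong (pair i j) (FP.<-irrelevant i<j i<j′)

coords∈allFin² : ∀ {n} (g : Pair n) → coords g ∈ cartesianProduct (allFin n) (allFin n)
coords∈allFin² (pair i j _) = ∈-cartesianProduct⁺ (∈-allFin i) (∈-allFin j)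

covered-tail : ∀ {n} {P : Pair n → Set} {c L} → (∀ g → P g → coords g ∈ c ∷ L) →
  (∀ g → coords g ≡ c → ¬ P g) → ∀ g → P g → coords g ∈ L
covered-tail cover excluded g pg with cover g pg
... | here g≡c = ⊥-elim (excluded g g≡c pg)
... | there g∈L = g∈L

excluding : ∀ {n} {P : Pair n → Set} {g₀} → ¬ P g₀ → ∀ g → coords g ≡ coords g₀ → ¬ P g
excluding {P = P} ¬P₀ g g≡ = subst (¬_ ∘ P) (sym (coords-injective g≡)) ¬P₀

consistent-all-pairs : ∀ {n l} (p : Fin n → Fin l) {D : Fin n → Set} (f : Fin n → Sign) →
  (∀ {i j} (i<j : i F.< j) → D i → D j → Consistent (f i) (f j) (XI p (pair i j i<j))) →
  ∀ {i j} → D i → D j → Consistent (f i) (f j) (cmpSign (toℕ (p i)) (toℕ (p j)))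
consistent-all-pairs p f f-consistent {i} {j} di dj with FP.<-cmp i j
... | tri< i<j _ _  = f-consistent i<j di dj
... | tri≈ _ refl _ = subst (Consistent (f i) (f i)) (sym (cmpSign-refl (toℕ (p i)))) (consistent-refl (f i))
... | tri> _ _ j<i  = subst (Consistent (f i) (f j)) (cmpSign-swap (toℕ (p j)) (toℕ (p i)))
                        (consistent-swap (f j) (f i) _ (f-consistent j<i dj di))

module _ {n : ℕ} {M : SignVec (Pair n) → Set} (M-sweep : IsSweepOM n M) where

  open IsSweepOM M-sweep using (isOM; sweep)
  open IsOM isOM

  B-resp : ∀ {Y R} → B n M R → (∀ e → Y e ≡ R e) → B n M Y
  B-resp (X , X∈M , l , p , p-surj , X≗ , k , 1≤k , k≤ , R≗) Y≗R =
    X , X∈M , l , p , p-surj , X≗ , k , 1≤k , k≤ , λ e → trans (Y≗R e) (R≗ e)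

  record Decomposition (Y : SignVec (Ext n)) : Set where
    field
      base       : SignVec (Pair n)
      base∈M     : M base
      restricts  : ∀ e → Y (inj₂ e) ≡ base e
      consistent : ∀ {i j} (i<j : i F.< j) → Consistent (Y (inj₁ i)) (Y (inj₁ j)) (base (pair i j i<j))

  decompose : ∀ {Y} → B n M Y → Decomposition Y
  decompose {Y} (X , X∈M , l , p , _ , X≗ , k , _ , _ , Y≗) = record
    { base       = X
    ; base∈M     = X∈M
    ; restricts  = λ e → Y≗ (inj₂ e)
    ; consistent = λ {i} {j} i<j →
        subst₂ (λ s t → Consistent s t (X (pair i j i<j))) (sym (Y≗ (inj₁ i))) (sym (Y≗ (inj₁ j)))
          (subst (Consistent _ _) (sym (X≗ (pair i j i<j))) (liftSign-consistent p k i j))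
    }

  extend : ∀ {U} → M U → {D : Fin n → Set} → (∀ i → Dec (D i)) → (f : Fin n → Sign) →
    (∀ {i j} (i<j : i F.< j) → D i → D j → Consistent (f i) (f j) (U (pair i j i<j))) →
    Σ[ R ∈ SignVec (Ext n) ] B n M R × (∀ e → R (inj₂ e) ≡ U e) × (∀ i → D i → R (inj₁ i) ≡ f i)
  extend {U} U∈M D? f f-consistent with sweep U U∈M
  ... | l , p , p-surj , U≗ with liftSign-extends p D? f
        (consistent-all-pairs p f λ i<j di dj → subst (Consistent _ _) (U≗ _) (f-consistent i<j di dj))
  ... | k , 1≤k , k≤ , agrees =
    Xk p U k , (U , U∈M , l , p , p-surj , U≗ , k , 1≤k , k≤ , λ _ → refl) , (λ _ → refl) , agrees

  glue∈B : ∀ {U} → M U → (f : Fin n → Sign) →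
    (∀ {i j} (i<j : i F.< j) → Consistent (f i) (f j) (U (pair i j i<j))) → B n M [ f , U ]
  glue∈B U∈M f f-consistent =
    let R , R∈B , R-pairs , R-elements =
          extend U∈M {D = λ _ → ⊤} (λ _ → yes tt) f (λ i<j _ _ → f-consistent i<j)
    in B-resp R∈B λ { (inj₁ i) → sym (R-elements i tt) ; (inj₂ e) → sym (R-pairs e) }

  B-zero : B n M zeroVec
  B-zero = B-resp (glue∈B V0 (λ _ → zer) (λ _ → _)) λ { (inj₁ _) → refl ; (inj₂ _) → refl }

  B-neg : ∀ {Y} → B n M Y → B n M (neg Y)
  B-neg {Y} Y∈B =
    B-resp (glue∈B (V1 base base∈M) (negS ∘ Y ∘ inj₁) λ i<j → consistent-neg _ _ _ (consistent i<j))
      λ { (inj₁ _) → refl ; (inj₂ e) → cong negS (restricts e) }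
    where open Decomposition (decompose Y∈B)

  module _ {Y Y′ : SignVec (Ext n)} (Y∈B : B n M Y) (Y′∈B : B n M Y′) where

    private
      module D  = Decomposition (decompose Y∈B)
      module D′ = Decomposition (decompose Y′∈B)

      sep-restricts : ∀ {e} → Sep Y Y′ (inj₂ e) → Sep D.base D′.base e
      sep-restricts {e} = subst₂ Opposite (D.restricts e) (D′.restricts e)

      sep-extends : ∀ {e} → Sep D.base D′.base e → Sep Y Y′ (inj₂ e)
      sep-extends {e} = subst₂ Opposite (sym (D.restricts e)) (sym (D′.restricts e))

      ⊙-restricts : ∀ e → (Y ⊙ Y′) (inj₂ e) ≡ (D.base ⊙ D′.base) e
      ⊙-restricts e = begin
        (Y ⊙ Y′) (inj₂ e)               ≡⟨ ⊙-pointwise Y Y′ (inj₂ e) ⟩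
        Y (inj₂ e) ⊙ˢ Y′ (inj₂ e)       ≡⟨ cong₂ _⊙ˢ_ (D.restricts e) (D′.restricts e) ⟩
        D.base e ⊙ˢ D′.base e           ≡⟨ ⊙-pointwise D.base D′.base e ⟨
        (D.base ⊙ D′.base) e            ∎
        where open ≡-Reasoning

      composed : Fin n → Sign
      composed i = Y (inj₁ i) ⊙ˢ Y′ (inj₁ i)

      Unseparated : Fin n → Set
      Unseparated i = ¬ Opposite (Y (inj₁ i)) (Y′ (inj₁ i))

      unseparated : ∀ {i a} → i ≢ a → i ≡ a ⊎ Unseparated i → Unseparated i
      unseparated i≢a = [ ⊥-elim ∘ i≢a , (λ u → u) ]

      zeroedAt : Fin n → Fin n → Sign
      zeroedAt a = updateAt composed a (λ _ → zer)

      zeroedAt-consistent : (∀ g → ¬ Sep Y Y′ (inj₂ g)) → ∀ {a} → Sep Y Y′ (inj₁ a) →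
        ∀ {i j} (i<j : i F.< j) → i ≡ a ⊎ Unseparated i → j ≡ a ⊎ Unseparated j →
        Consistent (zeroedAt a i) (zeroedAt a j) ((D.base ⊙ D′.base) (pair i j i<j))
      zeroedAt-consistent no-sep {a} sep-a {i} {j} i<j di dj
        rewrite ⊙-pointwise D.base D′.base (pair i j i<j) with i F.≟ a | j F.≟ a
      ... | yes refl | yes refl = ⊥-elim (FP.<-irrefl refl i<j)
      ... | yes refl | no j≢a
        rewrite updateAt-updates i {λ _ → zer} composed | updateAt-minimal j i {λ _ → zer} composed j≢a =
        consistent-zeroˡ _ _ _ _ _ _ sep-a (D.consistent i<j) (D′.consistent i<j)
          (unseparated j≢a dj) (no-sep _ ∘ sep-extends)
      ... | no i≢a   | yes refl
        rewrite updateAt-updates j {λ _ → zer} composed | updateAt-minimal i j {λ _ → zer} composed i≢a =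
        consistent-zeroʳ _ _ _ _ _ _ sep-a (D.consistent i<j) (D′.consistent i<j)
          (unseparated i≢a di) (no-sep _ ∘ sep-extends)
      ... | no i≢a   | no j≢a
        rewrite updateAt-minimal i a {λ _ → zer} composed i≢a
              | updateAt-minimal j a {λ _ → zer} composed j≢a =
        consistent-⊙ _ _ _ _ _ _ (D.consistent i<j) (D′.consistent i<j)

      eliminant-consistent : ∀ {U} → AgreesOffSep U D.base D′.base →
        ∀ {i j} (i<j : i F.< j) → Unseparated i → Unseparated j →
        Consistent (composed i) (composed j) (U (pair i j i<j))
      eliminant-consistent {U} U-agrees {i} {j} i<j ¬oi ¬oj =
        consistent-elim _ _ _ _ _ _ _ (D.consistent i<j) (D′.consistent i<j) ¬oi ¬oj
          (agrees-or-separated {U = U} U-agrees (pair i j i<j))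

    B-⊙ : B n M (Y ⊙ Y′)
    B-⊙ = B-resp (glue∈B (V2 D.base D′.base D.base∈M D′.base∈M) composed composed-consistent)
      λ { (inj₁ i) → ⊙-pointwise Y Y′ (inj₁ i) ; (inj₂ e) → ⊙-restricts e }
      where
      composed-consistent : ∀ {i j} (i<j : i F.< j) →
        Consistent (composed i) (composed j) ((D.base ⊙ D′.base) (pair i j i<j))
      composed-consistent i<j = subst (Consistent _ _) (sym (⊙-pointwise D.base D′.base _))
                                  (consistent-⊙ _ _ _ _ _ _ (D.consistent i<j) (D′.consistent i<j))

    eliminate-pair : ∀ g → Sep Y Y′ (inj₂ g) → Elimination (B n M) Y Y′ (inj₂ g)
    eliminate-pair g sep-g with V3 D.base D′.base D.base∈M D′.base∈M g (sep-restricts sep-g)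
    ... | U , U∈M , U-g , U-agrees =
      let R , R∈B , R-pairs , R-elements =
            extend U∈M (λ i → ¬? (opposite? _ _)) composed (eliminant-consistent U-agrees)
      in R , R∈B , trans (R-pairs g) U-g ,
         λ { (inj₁ i) ¬sep → trans (R-elements i ¬sep) (sym (⊙-pointwise Y Y′ (inj₁ i)))
           ; (inj₂ h) ¬sep →
               trans (R-pairs h) (trans (U-agrees h (¬sep ∘ sep-extends)) (sym (⊙-restricts h))) }

    eliminate-element-base : (∀ g → ¬ Sep Y Y′ (inj₂ g)) → ∀ a → Sep Y Y′ (inj₁ a) →
      Elimination (B n M) Y Y′ (inj₁ a)
    eliminate-element-base no-sep a sep-a =
      let R , R∈B , R-pairs , R-elements =
            extend (V2 D.base D′.base D.base∈M D′.base∈M) (λ i → i F.≟ a ⊎-dec ¬? (opposite? _ _))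
              (zeroedAt a) (zeroedAt-consistent no-sep sep-a)
      in R , R∈B , trans (R-elements a (inj₁ refl)) (updateAt-updates a composed) ,
         λ { (inj₁ i) ¬sep → trans (R-elements i (inj₂ ¬sep))
                               (trans (updateAt-minimal i a composed (λ { refl → ¬sep sep-a }))
                                 (sym (⊙-pointwise Y Y′ (inj₁ i))))
           ; (inj₂ h) _ → trans (R-pairs h) (sym (⊙-restricts h)) }

  separated-pair? : ∀ (Y Y′ : SignVec (Ext n)) i j →
    Dec (Σ[ i<j ∈ i F.< j ] Sep Y Y′ (inj₂ (pair i j i<j)))
  separated-pair? Y Y′ i j with i F.<? j
  ... | no ¬i<j = no (¬i<j ∘ proj₁)
  ... | yes i<j = map′ (i<j ,_)
                    (λ { (_ , sep) → subst (λ g → Sep Y Y′ (inj₂ g)) (coords-injective refl) sep })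
                    (opposite? _ _)

  eliminate-element : (L : List (Fin n × Fin n)) → ∀ {Y Y′} → B n M Y → B n M Y′ →
    (∀ g → Sep Y Y′ (inj₂ g) → coords g ∈ L) →
    ∀ a → Sep Y Y′ (inj₁ a) → Elimination (B n M) Y Y′ (inj₁ a)
  eliminate-element [] Y∈B Y′∈B cover =
    eliminate-element-base Y∈B Y′∈B λ g sep → case cover g sep of λ ()
  eliminate-element ((i , j) ∷ L) {Y} {Y′} Y∈B Y′∈B cover a sep-a with separated-pair? Y Y′ i j
  ... | no ¬sep = eliminate-element L Y∈B Y′∈B
                    (covered-tail cover λ { (pair _ _ i<j) refl sep → ¬sep (i<j , sep) }) a sep-a
  ... | yes (i<j , sep-g) = reduce (eliminate-pair Y∈B Y′∈B (pair i j i<j) sep-g)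
    where
    reduce : Elimination (B n M) Y Y′ (inj₂ (pair i j i<j)) → Elimination (B n M) Y Y′ (inj₁ a)
    reduce (W , W∈B , W-g , W-agrees) with opposite-trichotomy sep-a (W (inj₁ a))
    ... | inj₁ W-a = W , W∈B , W-a , W-agrees
    ... | inj₂ (inj₁ Y-a-opposite) =
      elimination-transfer (sep-⊙ˡ W-agrees) (agrees-⊙ˡ W-agrees)
        (eliminate-element L Y∈B (B-⊙ W∈B Y∈B)
          (covered-tail (λ g → cover g ∘ sep-⊙ˡ W-agrees (inj₂ g))
            (excluding (zero-⊙ˡ Y W W-g)))
          a (separates-⊙ˡ Y W Y-a-opposite))
    ... | inj₂ (inj₂ Y′-a-opposite) =
      elimination-transfer (sep-⊙ʳ W-agrees) (agrees-⊙ʳ W-agrees)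
        (eliminate-element L (B-⊙ W∈B Y′∈B) Y′∈B
          (covered-tail (λ g → cover g ∘ sep-⊙ʳ W-agrees (inj₂ g))
            (excluding (zero-⊙ʳ W Y′ W-g)))
          a (separates-⊙ʳ W Y′ Y′-a-opposite))

  B-isOM : IsOM (Ext n) (B n M)
  B-isOM = record
    { V0 = B-zero
    ; V1 = λ _ → B-neg
    ; V2 = λ _ _ → B-⊙
    ; V3 = λ { Y Y′ Y∈B Y′∈B (inj₂ g) → eliminate-pair Y∈B Y′∈B g
             ; Y Y′ Y∈B Y′∈B (inj₁ a) →
                 eliminate-element _ Y∈B Y′∈B (λ g _ → coords∈allFin² g) a }
    }

theorem4p1 : (n : ℕ) (M : SignVec (Pair n) → Set) →
    IsSweepOM n M → IsOM (Ext n) (B n M)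
theorem4p1 n M = B-isOM
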